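{- For every $\alpha\ge1$, the function $E_{\alpha}^{*}(\cdot)$ on edge streams is $2$-almost-smooth.
   Context: Edge streams are sequences of edges on the vertex set $V=[n]$ with no edge repeated. For a stream $S=(e_1,\dots,e_k)$, an edge $e_i=\{u,v\}$ is $\alpha$-good (with respect to $S$) if $d_i(u)\le\alpha$ and $d_i(v)\le\alpha$, where $d_i(x)=|\{e_j: j>i,\ x\in e_j\}|$ is the number of edges incident on $x$ appearing after $e_i$ in $S$. $E_\alpha(S)$ is the set of $\alpha$-good edges of $S$, and $E_\alpha^*(S)=\max_{t\in[k]}|E_\alpha(S_t)|$, where $S_t=(e_1,\dots,e_t)$. For disjoint consecutive segments $A,B$, $AB$ is their concatenation. A function $f$ on streams is $2$-almost-smooth if: (1) $f(A)\ge0$ for all $A$; (2) $f(B)\le f(AB)$ for all disjoint segments $A,B$; (3) $f(A)\le\mathrm{poly}(n)$ for all $A$; (4) for all disjoint segments $A,B,C$, $\frac{f(B)}{f(AB)}\le2\cdot\frac{f(BC)}{f(ABC)}$ whenever $f(AB)\ne0$ and $f(ABC)\ne0$. -}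

module Defs where

open import Data.Nat using (ℕ; zero; suc; _+_; _*_; _^_; _≤_; _≤?_; _⊔_)
open import Data.Fin using (Fin)
import Data.Fin as Fin
open import Data.Product using (Σ; ∃; ∃-syntax; _×_; _,_; proj₁; proj₂)
open import Data.Sum using (_⊎_)
open import Data.List using (List; []; _∷_; _++_; length; inits; map; foldr)
open import Data.List.Relation.Unary.Unique.Propositional using (Unique)
open import Data.Bool using (Bool; true; false; if_then_else_; _∧_; _∨_)
open import Relation.Nullary.Decidable using (⌊_⌋)
open import Relation.Binary.PropositionalEquality using (_≡_; _≢_)

-- An (undirected, loopless) edge {u,v} on the vertex set [n] = Fin n,
-- represented canonically by its endpoints u < v.
Edge : ℕ → Set
Edge n = Σ (Fin n × Fin n) (λ p → proj₁ p Fin.< proj₂ p)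

-- A stream is a list of edges (first element = e₁).  An edge stream must
-- not repeat an edge: this is the predicate `ValidStream`.
Stream : ℕ → Set
Stream n = List (Edge n)

ValidStream : ∀ {n} → Stream n → Set
ValidStream S = Unique S

incident : ∀ {n} → Fin n → Edge n → Bool
incident x ((u , v) , _) = ⌊ x Fin.≟ u ⌋ ∨ ⌊ x Fin.≟ v ⌋

deg : ∀ {n} → Fin n → Stream n → ℕ
deg x [] = 0
deg x (e ∷ es) = (if incident x e then 1 else 0) + deg x es

-- E_α(S): the α-good edges of S.  The head edge e of (e ∷ rest) is α-good
-- iff both endpoints have at most α incident edges in `rest`
-- (the edges appearing after e).
goodEdges : ∀ {n} → ℕ → Stream n → List (Edge n)
goodEdges α [] = []
goodEdges α (((u , v) , p) ∷ rest) =
  if ⌊ deg u rest ≤? α ⌋ ∧ ⌊ deg v rest ≤? α ⌋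
  then ((u , v) , p) ∷ goodEdges α rest
  else goodEdges α rest

Ecard : ∀ {n} → ℕ → Stream n → ℕ
Ecard α S = length (goodEdges α S)

-- E*_α(S) = max over prefixes S_t of |E_α(S_t)|  (the empty prefix
-- contributes 0, so this equals the max over t ∈ [k]; it is 0 for the
-- empty stream).
Estar : ∀ {n} → ℕ → Stream n → ℕ
Estar α S = foldr _⊔_ 0 (map (Ecard α) (inits S))

-- Condition (1) f(A) ≥ 0 is automatic since f is ℕ-valued.
-- Disjoint consecutive segments A, B (, C) = lists whose concatenation is
-- a valid edge stream.  Condition (4) is stated cross-multiplied
-- (denominators are nonzero naturals).
AlmostSmooth2 : (∀ {n} → Stream n → ℕ) → Set
AlmostSmooth2 f =
    (∀ n (A B : Stream n) → ValidStream (A ++ B) → f B ≤ f (A ++ B))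
  × (∃[ c ] ∃[ k ] ∀ n (A : Stream n) → ValidStream A → f A ≤ c * suc n ^ k)
  × (∀ n (A B C : Stream n) → ValidStream (A ++ B ++ C) →
       f (A ++ B) ≢ 0 → f (A ++ B ++ C) ≢ 0 →
       f B * f (A ++ B ++ C) ≤ 2 * (f (B ++ C) * f (A ++ B)))

-- Removing edges from the end of a stream only lowers the degrees that decide
-- α-goodness.  So E_α(XR) consists of E_α(R) together with the edges of X that
-- are α-good in XR, and an edge of A that is α-good in ABC′ is already α-good
-- in AB; hence |E_α(ABC′)| ≤ |E_α(AB)| + |E_α(BC′)| and, taking maxima over
-- prefixes, f(ABC) ≤ f(AB) + f(BC) for f = E*_α.  Since also f(B) ≤ f(AB) and
-- f(B) ≤ f(BC), we get f(B) f(ABC) ≤ f(B) (f(AB) + f(BC)) ≤ 2 f(AB) f(BC).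
-- The polynomial bound is n², the number of possible edges.
module Submission where

open import Defs
open import Data.Nat using (ℕ; suc; _+_; _*_; _^_; _⊔_; _≤_; _≤?_; z≤n; s≤s)
open import Data.Nat.Properties
open import Data.Bool using (Bool; true; false; T; if_then_else_; _∧_)
open import Data.Bool.Properties using (T-∧)
open import Data.Empty using (⊥-elim)
open import Data.Fin using (Fin; combine)
import Data.Fin as Fin
import Data.Fin.Properties as Fin
open import Data.List using (List; []; _∷_; _++_; length; inits; map; foldr; lookup)
open import Data.List.Properties using (++-assoc; ++-identityʳ; length-++; map-∘; ∷-injective)
open import Data.List.Membership.Propositional.Properties using (∈-lookup)
open import Data.List.Relation.Unary.All as All using ()
open import Data.List.Relation.Unary.AllPairs using (AllPairs; _∷_)
open import Data.List.Relation.Unary.Unique.Propositional using (Unique)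
open import Data.Product using (∃-syntax; _×_; _,_)
open import Data.Sum using (_⊎_; inj₁; inj₂)
open import Function using (_∘_; Equivalence)
open import Function.Definitions using (Injective)
open import Relation.Nullary.Decidable using (⌊_⌋; yes; no; toWitness; fromWitness)
open import Relation.Binary.PropositionalEquality

private
  variable
    A : Set

prefix-of-++ : (ys zs xs ws : List A) → ys ++ zs ≡ xs ++ ws →
  (∃[ ys′ ] ys ++ ys′ ≡ xs) ⊎ (∃[ ws′ ] ys ≡ xs ++ ws′ × ws′ ++ zs ≡ ws)
prefix-of-++ ys       zs []       ws eq = inj₂ (ys , refl , eq)
prefix-of-++ []       zs (x ∷ xs) ws eq = inj₁ (x ∷ xs , refl)
prefix-of-++ (y ∷ ys) zs (x ∷ xs) ws eq with refl , eq′ ← ∷-injective eq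
  with prefix-of-++ ys zs xs ws eq′
... | inj₁ (ys′ , p) = inj₁ (ys′ , cong (y ∷_) p)
... | inj₂ (ws′ , p , q) = inj₂ (ws′ , cong (y ∷_) p , q)

length-if-∷-mono : ∀ b b′ {x y : A} {xs ys} → (T b → T b′) → length xs ≤ length ys →
  length (if b then x ∷ xs else xs) ≤ length (if b′ then y ∷ ys else ys)
length-if-∷-mono true  true  _   le = s≤s le
length-if-∷-mono true  false b⇒b′ _ = ⊥-elim (b⇒b′ _)
length-if-∷-mono false true  _   le = m≤n⇒m≤1+n le
length-if-∷-mono false false _   le = le

AllPairs-lookup : ∀ {R : A → A → Set} {xs : List A} → AllPairs R xs →
  ∀ {i j} → i Fin.< j → R (lookup xs i) (lookup xs j)
AllPairs-lookup (px ∷ _)   {Fin.zero}  {Fin.suc j} _         = All.lookup px (∈-lookup j)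
AllPairs-lookup (_ ∷ pxs) {Fin.suc i} {Fin.suc j} (s≤s i<j) = AllPairs-lookup pxs i<j

Unique⇒length≤ : ∀ {m} (enc : A → Fin m) → Injective _≡_ _≡_ enc →
  ∀ {xs} → Unique xs → length xs ≤ m
Unique⇒length≤ {m = m} enc enc-inj {xs} unique with length xs ≤? m
... | yes le = le
... | no ≰ with i , j , i<j , eq ← Fin.pigeonhole (≰⇒> ≰) (enc ∘ lookup xs)
  = ⊥-elim (AllPairs-lookup unique i<j (enc-inj eq))

maxOverPrefixes : (List A → ℕ) → List A → ℕ
maxOverPrefixes h xs = foldr _⊔_ 0 (map h (inits xs))

maxOverPrefixes-∷ : ∀ (h : List A → ℕ) x xs →
  maxOverPrefixes h (x ∷ xs) ≡ h [] ⊔ maxOverPrefixes (h ∘ (x ∷_)) xs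
maxOverPrefixes-∷ h x xs = cong (λ hs → h [] ⊔ foldr _⊔_ 0 hs) (sym (map-∘ (inits xs)))

≤-maxOverPrefixes : ∀ (h : List A → ℕ) ys zs {xs} → ys ++ zs ≡ xs →
  h ys ≤ maxOverPrefixes h xs
≤-maxOverPrefixes h [] [] refl = m≤m⊔n (h []) 0
≤-maxOverPrefixes h [] (z ∷ zs) refl
  rewrite maxOverPrefixes-∷ h z zs = m≤m⊔n (h []) _
≤-maxOverPrefixes h (y ∷ ys) zs refl
  rewrite maxOverPrefixes-∷ h y (ys ++ zs) =
  ≤-trans (≤-maxOverPrefixes (h ∘ (y ∷_)) ys zs refl) (m≤n⊔m (h []) _)

maxOverPrefixes-lub : ∀ (h : List A → ℕ) xs {m} →
  (∀ ys zs → ys ++ zs ≡ xs → h ys ≤ m) → maxOverPrefixes h xs ≤ m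
maxOverPrefixes-lub h [] bound = ⊔-lub (bound [] [] refl) z≤n
maxOverPrefixes-lub h (x ∷ xs) bound rewrite maxOverPrefixes-∷ h x xs =
  ⊔-lub (bound [] (x ∷ xs) refl)
        (maxOverPrefixes-lub (h ∘ (x ∷_)) xs
          (λ ys zs eq → bound (x ∷ ys) zs (cong (x ∷_) eq)))

maxOverPrefixes-mono-++ : ∀ (h : List A → ℕ) xs ys →
  maxOverPrefixes h xs ≤ maxOverPrefixes h (xs ++ ys)
maxOverPrefixes-mono-++ h xs ys = maxOverPrefixes-lub h xs λ ps qs eq →
  ≤-maxOverPrefixes h ps (qs ++ ys) (trans (sym (++-assoc ps qs ys)) (cong (_++ ys) eq))

module _ {n : ℕ} where

  _≤ᵈ_ : Stream n → Stream n → Set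
  R ≤ᵈ R′ = ∀ x → deg x R ≤ deg x R′

  ≤ᵈ-++ʳ : ∀ R R′ → R ≤ᵈ (R ++ R′)
  ≤ᵈ-++ʳ []      R′ x = z≤n
  ≤ᵈ-++ʳ (e ∷ R) R′ x = +-monoʳ-≤ (if incident x e then 1 else 0) (≤ᵈ-++ʳ R R′ x)

  ++-monoʳ-≤ᵈ : ∀ X {R R′} → R ≤ᵈ R′ → (X ++ R) ≤ᵈ (X ++ R′)
  ++-monoʳ-≤ᵈ []      R≤R′ x = R≤R′ x
  ++-monoʳ-≤ᵈ (e ∷ X) R≤R′ x =
    +-monoʳ-≤ (if incident x e then 1 else 0) (++-monoʳ-≤ᵈ X R≤R′ x)

  isGood : ℕ → Edge n → Stream n → Bool
  isGood α ((u , v) , _) rest = ⌊ deg u rest ≤? α ⌋ ∧ ⌊ deg v rest ≤? α ⌋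

  isGood-antitone : ∀ α e {R R′} → R ≤ᵈ R′ → T (isGood α e R′) → T (isGood α e R)
  isGood-antitone α ((u , v) , _) {R} {R′} R≤R′ good
    with gu , gv ← Equivalence.to T-∧ good =
    Equivalence.from T-∧ (lower u gu , lower v gv)
    where
    lower : ∀ x → T ⌊ deg x R′ ≤? α ⌋ → T ⌊ deg x R ≤? α ⌋
    lower x g = fromWitness (≤-trans (R≤R′ x) (toWitness g))

  goodEdgesBefore : ℕ → Stream n → Stream n → List (Edge n)
  goodEdgesBefore α []      R = []
  goodEdgesBefore α (e ∷ X) R =
    if isGood α e (X ++ R) then e ∷ goodEdgesBefore α X R else goodEdgesBefore α X R

  goodEdges-++ : ∀ α X R → goodEdges α (X ++ R) ≡ goodEdgesBefore α X R ++ goodEdges α R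
  goodEdges-++ α []      R = refl
  goodEdges-++ α (e ∷ X) R with isGood α e (X ++ R)
  ... | true  = cong (e ∷_) (goodEdges-++ α X R)
  ... | false = goodEdges-++ α X R

  Ecard-++ : ∀ α X R → Ecard α (X ++ R) ≡ length (goodEdgesBefore α X R) + Ecard α R
  Ecard-++ α X R = trans (cong length (goodEdges-++ α X R)) (length-++ (goodEdgesBefore α X R))

  length-goodEdgesBefore-antitone : ∀ α X {R R′} → R ≤ᵈ R′ →
    length (goodEdgesBefore α X R′) ≤ length (goodEdgesBefore α X R)
  length-goodEdgesBefore-antitone α []      R≤R′ = z≤n
  length-goodEdgesBefore-antitone α (e ∷ X) {R} {R′} R≤R′ =
    length-if-∷-mono (isGood α e (X ++ R′)) (isGood α e (X ++ R))
      (isGood-antitone α e {X ++ R} {X ++ R′} (++-monoʳ-≤ᵈ X R≤R′))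
      (length-goodEdgesBefore-antitone α X R≤R′)

  Ecard≤length : ∀ α S → Ecard α S ≤ length S
  Ecard≤length α []      = z≤n
  Ecard≤length α (e ∷ S) =
    length-if-∷-mono (isGood α e S) true {e} {e} {goodEdges α S} {S} (λ _ → _) (Ecard≤length α S)

  Ecard-mono-++ˡ : ∀ α X R → Ecard α R ≤ Ecard α (X ++ R)
  Ecard-mono-++ˡ α X R rewrite Ecard-++ α X R = m≤n+m (Ecard α R) _

  Ecard-overlap : ∀ α A B C → Ecard α (A ++ B ++ C) ≤ Ecard α (A ++ B) + Ecard α (B ++ C)
  Ecard-overlap α A B C = begin
    Ecard α (A ++ B ++ C)
      ≡⟨ Ecard-++ α A (B ++ C) ⟩
    length (goodEdgesBefore α A (B ++ C)) + Ecard α (B ++ C)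
      ≤⟨ +-monoˡ-≤ _ (length-goodEdgesBefore-antitone α A (≤ᵈ-++ʳ B C)) ⟩
    length (goodEdgesBefore α A B) + Ecard α (B ++ C)
      ≤⟨ +-monoˡ-≤ _ (m≤m+n (length (goodEdgesBefore α A B)) (Ecard α B)) ⟩
    length (goodEdgesBefore α A B) + Ecard α B + Ecard α (B ++ C)
      ≡⟨ cong (_+ Ecard α (B ++ C)) (sym (Ecard-++ α A B)) ⟩
    Ecard α (A ++ B) + Ecard α (B ++ C)
      ∎
    where open ≤-Reasoning

  edgeCode : Edge n → Fin (n * n)
  edgeCode ((u , v) , _) = combine u v

  edgeCode-injective : Injective _≡_ _≡_ edgeCode
  edgeCode-injective {(u , v) , p} {(u′ , v′) , p′} eq
    with refl , refl ← Fin.combine-injective u v u′ v′ eq =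
    cong ((u , v) ,_) (Fin.<-irrelevant p p′)

  length≤n² : ∀ {S} → ValidStream S → length S ≤ n * n
  length≤n² = Unique⇒length≤ edgeCode edgeCode-injective

-- Estar α is definitionally maxOverPrefixes (Ecard α).
module _ {n : ℕ} (α : ℕ) where

  Estar-mono-++ˡ : ∀ (A B : Stream n) → Estar α B ≤ Estar α (A ++ B)
  Estar-mono-++ˡ A B = maxOverPrefixes-lub (Ecard α) B λ P Q eq →
    ≤-trans (Ecard-mono-++ˡ α A P)
            (≤-maxOverPrefixes (Ecard α) (A ++ P) Q (trans (++-assoc A P Q) (cong (A ++_) eq)))

  Estar-mono-++ʳ : ∀ (B C : Stream n) → Estar α B ≤ Estar α (B ++ C)
  Estar-mono-++ʳ = maxOverPrefixes-mono-++ (Ecard α)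

  Estar-overlap : ∀ (A B C : Stream n) →
    Estar α (A ++ B ++ C) ≤ Estar α (A ++ B) + Estar α (B ++ C)
  Estar-overlap A B C = maxOverPrefixes-lub (Ecard α) (A ++ B ++ C) λ P Q eq →
    bound P Q (prefix-of-++ P Q (A ++ B) C (trans eq (sym (++-assoc A B C))))
    where
    bound : ∀ P Q → (∃[ Q′ ] P ++ Q′ ≡ A ++ B) ⊎ (∃[ C′ ] P ≡ (A ++ B) ++ C′ × C′ ++ Q ≡ C) →
            Ecard α P ≤ Estar α (A ++ B) + Estar α (B ++ C)
    bound P _ (inj₁ (Q′ , eq)) = ≤-trans (≤-maxOverPrefixes (Ecard α) P Q′ eq) (m≤m+n _ _)
    bound _ Q (inj₂ (C′ , refl , eq)) = begin
      Ecard α ((A ++ B) ++ C′)            ≡⟨ cong (Ecard α) (++-assoc A B C′) ⟩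
      Ecard α (A ++ B ++ C′)              ≤⟨ Ecard-overlap α A B C′ ⟩
      Ecard α (A ++ B) + Ecard α (B ++ C′)
        ≤⟨ +-mono-≤ (≤-maxOverPrefixes (Ecard α) (A ++ B) [] (++-identityʳ (A ++ B)))
                    (≤-maxOverPrefixes (Ecard α) (B ++ C′) Q (trans (++-assoc B C′ Q) (cong (B ++_) eq))) ⟩
      Estar α (A ++ B) + Estar α (B ++ C) ∎
      where open ≤-Reasoning

  Estar≤length : ∀ (S : Stream n) → Estar α S ≤ length S
  Estar≤length S = maxOverPrefixes-lub (Ecard α) S λ P Q eq →
    ≤-trans (Ecard≤length α P)
            (subst (length P ≤_) (trans (sym (length-++ P)) (cong length eq))
                   (m≤m+n (length P) (length Q)))

product-≤-twice : ∀ {x y z w} → z ≤ x → z ≤ y → w ≤ x + y → z * w ≤ 2 * (y * x)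
product-≤-twice {x} {y} {z} {w} z≤x z≤y w≤x+y = begin
  z * w              ≤⟨ *-monoʳ-≤ z w≤x+y ⟩
  z * (x + y)        ≡⟨ *-distribˡ-+ z x y ⟩
  z * x + z * y      ≤⟨ +-mono-≤ (*-monoˡ-≤ x z≤y) (*-monoˡ-≤ y z≤x) ⟩
  y * x + x * y      ≡⟨ cong (y * x +_) (trans (*-comm x y) (sym (+-identityʳ (y * x)))) ⟩
  2 * (y * x)        ∎
  where open ≤-Reasoning

n*n≤[1+n]^2 : ∀ n → n * n ≤ 1 * suc n ^ 2
n*n≤[1+n]^2 n = begin
  n * n                  ≤⟨ *-mono-≤ (n≤1+n n) (n≤1+n n) ⟩
  suc n * suc n          ≡⟨ cong (suc n *_) (sym (*-identityʳ (suc n))) ⟩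
  suc n ^ 2              ≡⟨ sym (*-identityˡ (suc n ^ 2)) ⟩
  1 * suc n ^ 2          ∎
  where open ≤-Reasoning

lemma3p3 : (α : ℕ) → 1 ≤ α → AlmostSmooth2 (λ {n} S → Estar {n} α S)
lemma3p3 α _ = monotone , polynomiallyBounded , smooth
  where
  monotone : ∀ n (A B : Stream n) → ValidStream (A ++ B) → Estar α B ≤ Estar α (A ++ B)
  monotone n A B _ = Estar-mono-++ˡ α A B

  polynomiallyBounded : ∃[ c ] ∃[ k ] ∀ n (A : Stream n) → ValidStream A → Estar α A ≤ c * suc n ^ k
  polynomiallyBounded = 1 , 2 , λ n A valid →
    ≤-trans (Estar≤length α A) (≤-trans (length≤n² valid) (n*n≤[1+n]^2 n))

  smooth : ∀ n (A B C : Stream n) → ValidStream (A ++ B ++ C) →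
    Estar α (A ++ B) ≢ 0 → Estar α (A ++ B ++ C) ≢ 0 →
    Estar α B * Estar α (A ++ B ++ C) ≤ 2 * (Estar α (B ++ C) * Estar α (A ++ B))
  smooth n A B C _ _ _ =
    product-≤-twice (Estar-mono-++ˡ α A B) (Estar-mono-++ʳ α B C) (Estar-overlap α A B C)
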